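{- Let $G$ be a (finite, simple, connected) graph of order $n$ such that $\frac{n}{2}<\tau(G)=n-k$, and let $W$ be its $\tau$-set. If $G[W]$ is a complete graph $K_{\tau(G)}$, then $\beta_p(G)\le n-k/2$.
   Context: Two vertices $u,v$ are twins if $N(u)\setminus\{v\}=N(v)\setminus\{u\}$. A twin set is a set of pairwise twin vertices; twin classes are the equivalence classes of the twin relation and $\tau(G)$ is the maximum cardinality of a twin class. A $\tau$-set is a twin set of cardinality $\tau(G)$ (when $\tau(G)>n/2$ it is unique). $G[W]$ is the subgraph induced by $W$. For $u$ a vertex and $S$ a vertex set, $d(u,S)=\min_{w\in S}d(u,w)$. A partition $\Pi=\{S_1,\dots,S_k\}$ of $V(G)$ is locating if the vectors $r(u|\Pi)=(d(u,S_1),\dots,d(u,S_k))$ are pairwise distinct over $u\in V(G)$; $\beta_p(G)$ is the minimum size of a locating partition. -}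

module Defs where

open import Data.Nat using (ℕ; zero; suc; _≤_)
open import Data.Fin using (Fin)
open import Data.Fin.Subset using (Subset; _∈_; ∣_∣)
open import Data.Bool using (Bool; true; false)
open import Data.Product using (Σ; ∃; _×_; _,_)
open import Relation.Binary.PropositionalEquality using (_≡_; _≢_)
open import Function.Bundles using (_⇔_)

record Graph (n : ℕ) : Set where
  field
    adj   : Fin n → Fin n → Bool
    irrefl : ∀ u → adj u u ≡ false
    sym   : ∀ u v → adj u v ≡ adj v u
open Graph public

module _ {n : ℕ} (G : Graph n) where

  data Walk : Fin n → Fin n → ℕ → Set where
    here : ∀ {u} → Walk u u zero
    step : ∀ {u w v m} → adj G u w ≡ true → Walk w v m → Walk u v (suc m)

  Connected : Set
  Connected = ∀ u v → ∃ λ m → Walk u v m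

  DistTo : Fin n → (Fin n → Set) → ℕ → Set
  DistTo u S m =
    (∃ λ w → S w × Walk u w m) ×
    (∀ w l → S w → Walk u w l → m ≤ l)

  Twins : Fin n → Fin n → Set
  Twins u v = ∀ w → w ≢ u → w ≢ v → adj G u w ≡ adj G v w

  TwinSet : Subset n → Set
  TwinSet S = ∀ u v → u ∈ S → v ∈ S → Twins u v

  TwinClass : Subset n → Set
  TwinClass S = ∃ λ u → ∀ v → (v ∈ S ⇔ Twins u v)

  IsTau : ℕ → Set
  IsTau t = (∃ λ C → TwinClass C × ∣ C ∣ ≡ t) ×
            (∀ C → TwinClass C → ∣ C ∣ ≤ t)

  InducesComplete : Subset n → Set
  InducesComplete W = ∀ u v → u ∈ W → v ∈ W → u ≢ v → adj G u v ≡ true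

  -- A partition Π = {S_0,…,S_(p-1)} of V(G) into p nonempty parts, given by
  -- the part-label map f : part i is S_i = { w | f w ≡ i }.
  IsLocatingPartition : (p : ℕ) → (Fin n → Fin p) → Set
  IsLocatingPartition p f =
    (∀ i → ∃ λ w → f w ≡ i) ×
    (∀ u v → u ≢ v →
       ∃ λ i → ∃ λ a → ∃ λ b →
         DistTo u (λ w → f w ≡ i) a × DistTo v (λ w → f w ≡ i) b × a ≢ b)

module Submission where

-- Let W be the τ-set of G, a clique, and X = V(G) ∖ W, so |X| = k < |W| = t.
-- Fix a hub vertex h ∈ W.  Every x ∈ X adjacent to W is not a twin of h
-- (a τ-set absorbs all twins of its members), and the vertex telling x and
-- h apart must lie in X; call it a distinguisher of x.  An Ore-type
-- argument (a minimal dominating set and its complement) yields S ⊆ X with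
-- |S| ≤ k/2 such that every x ∈ X ∖ S adjacent to W has a distinguisher in S.
-- The partition: each w ∈ W gets its own part, the k - |S| vertices of X ∖ S
-- join pairwise different parts of W ∖ {h}, and every s ∈ S is a singleton
-- part; so it has t + |S| ≤ n - k/2 parts.  Only pairs (w, x) share a part,
-- and they are separated by a singleton part {s} (x adjacent to W) or {h}
-- (x not adjacent to W): one of them is adjacent to it, the other is not.

open import Defs hiding (sym)
open import Data.Nat using (ℕ; zero; suc; _+_; _*_; _<_; _≤_; _∸_; z≤n; s≤s; _≤?_)
open import Data.Nat.Properties
  using (≮⇒≥; ≰⇒>; m<1+n⇒m<n∨m≡n; n<1+n; <⇒≤; <⇒≢; <-≤-trans; ≤-trans; ≤-pred;
         <-irrefl; +-mono-<; +-monoʳ-≤; +-cancelˡ-<; +-identityʳ; +-assoc;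
         *-distribˡ-+; m+n∸m≡n; module ≤-Reasoning; m+n∸n≡m; m+[n∸m]≡n)
open import Data.Fin using (Fin; zero; suc; _≟_; toℕ; fromℕ<; inject≤; join; splitAt)
open import Data.Fin.Properties
  using (any?; all?; ¬∀⟶∃¬; toℕ-fromℕ<; toℕ-inject≤; toℕ<n; toℕ-injective;
         splitAt-join; join-splitAt)
open import Data.Fin.Subset using (Subset; _∈_; _∉_; ∣_∣; ∁; _-_; ⊤; _⊂_)
open import Data.Fin.Subset.Properties
  using (_∈?_; x∈∁p⇒x∉p; x∉p⇒x∈∁p; x∉∁p⇒x∈p; x∈p∧x≢y⇒x∈p-y; x∈p⇒∣p-x∣<∣p∣;
         ∈⊤; p⊂q⇒∣p∣<∣q∣; ∣∁p∣≡n∸∣p∣; ∣p∣≤n)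
open import Data.Vec using (_∷_; []; tabulate)
open import Data.Vec.Base using (here; there)
open import Data.Vec.Properties using ([]=⇒lookup; lookup⇒[]=; lookup∘tabulate)
open import Data.Bool using (true; false)
import Data.Bool.Properties as Bool
open import Data.Product using (_×_; ∃; _,_; proj₁; proj₂)
open import Data.Sum using (_⊎_; inj₁; inj₂)
open import Data.Sum.Properties using (inj₁-injective; inj₂-injective)
open import Data.Empty using (⊥-elim)
open import Function.Bundles using (mk⇔)
open import Relation.Nullary using (¬_; Dec; yes; no; does)
open import Relation.Nullary.Decidable using (_×-dec_; _→-dec_; ¬?; dec-true)
open import Relation.Binary.PropositionalEquality
  using (_≡_; _≢_; refl; cong; subst; subst₂; trans; sym; module ≡-Reasoning)

record Enumeration {m : ℕ} (P : Subset m) : Set where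
  field
    element       : Fin ∣ P ∣ → Fin m
    element∈      : ∀ r → element r ∈ P
    index         : ∀ i → i ∈ P → Fin ∣ P ∣
    element-index : ∀ i (i∈P : i ∈ P) → element (index i i∈P) ≡ i
    index-element : ∀ r (r∈P : element r ∈ P) → index (element r) r∈P ≡ r

  index-injective : ∀ i i′ (i∈P : i ∈ P) (i′∈P : i′ ∈ P) →
                    index i i∈P ≡ index i′ i′∈P → i ≡ i′
  index-injective i i′ i∈P i′∈P eq = begin
    i                       ≡⟨ sym (element-index i i∈P) ⟩
    element (index i i∈P)   ≡⟨ cong element eq ⟩
    element (index i′ i′∈P) ≡⟨ element-index i′ i′∈P ⟩
    i′                      ∎
    where open ≡-Reasoning

  element-injective : ∀ r r′ → element r ≡ element r′ → r ≡ r′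
  element-injective r r′ eq =
    trans (sym (index-element r (element∈ r))) (index-of eq (element∈ r))
    where
    index-of : ∀ {i} → i ≡ element r′ → (i∈P : i ∈ P) → index i i∈P ≡ r′
    index-of refl i∈P = index-element r′ i∈P

enumerate : ∀ {m} (P : Subset m) → Enumeration P
enumerate [] = record
  { element = λ () ; element∈ = λ () ; index = λ ()
  ; element-index = λ () ; index-element = λ () }
enumerate (true ∷ P) = record
  { element = element ; element∈ = element∈ ; index = index
  ; element-index = element-index ; index-element = index-element }
  where
  module E = Enumeration (enumerate P)
  element : Fin (suc ∣ P ∣) → Fin _
  element zero    = zero
  element (suc r) = suc (E.element r)
  element∈ : ∀ r → element r ∈ (true ∷ P)
  element∈ zero    = here
  element∈ (suc r) = there (E.element∈ r)
  index : ∀ i → i ∈ (true ∷ P) → Fin (suc ∣ P ∣)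
  index zero    _         = zero
  index (suc i) (there h) = suc (E.index i h)
  element-index : ∀ i h → element (index i h) ≡ i
  element-index zero    here      = refl
  element-index (suc i) (there h) = cong suc (E.element-index i h)
  index-element : ∀ r h → index (element r) h ≡ r
  index-element zero    here      = refl
  index-element (suc r) (there h) = cong suc (E.index-element r h)
enumerate (false ∷ P) = record
  { element = λ r → suc (E.element r) ; element∈ = λ r → there (E.element∈ r)
  ; index = index ; element-index = element-index ; index-element = index-element }
  where
  module E = Enumeration (enumerate P)
  index : ∀ i → i ∈ (false ∷ P) → Fin ∣ P ∣
  index (suc i) (there h) = E.index i h
  element-index : ∀ i h → suc (E.element (index i h)) ≡ i
  element-index (suc i) (there h) = cong suc (E.element-index i h)
  index-element : ∀ r h → index (suc (E.element r)) h ≡ r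
  index-element r (there h) = E.index-element r h

least-below : (P : ℕ → Set) → (∀ m → Dec (P m)) → ∀ b →
              (∃ λ m → P m × (∀ l → P l → m ≤ l)) ⊎ (∀ l → l < b → ¬ P l)
least-below P P? zero = inj₂ λ _ ()
least-below P P? (suc b) with least-below P P? b
... | inj₁ found = inj₁ found
... | inj₂ none with P? b
...   | yes pb  = inj₁ (b , pb , λ l pl → ≮⇒≥ λ l<b → none l l<b pl)
...   | no ¬pb  = inj₂ below
  where
  below : ∀ l → l < suc b → ¬ P l
  below l l<1+b with m<1+n⇒m<n∨m≡n l<1+b
  ... | inj₁ l<b  = none l l<b
  ... | inj₂ refl = ¬pb

least : (P : ℕ → Set) → (∀ m → Dec (P m)) → ∀ N → P N →
        ∃ λ m → P m × (∀ l → P l → m ≤ l)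
least P P? N pN with least-below P P? (suc N)
... | inj₁ found = found
... | inj₂ none  = ⊥-elim (none N (n<1+n N) pN)

Separated : ∀ {n p} (G : Graph n) (f : Fin n → Fin p) → Fin n → Fin n → Set
Separated G f u v = ∃ λ i → ∃ λ a → ∃ λ b →
  DistTo G u (λ w → f w ≡ i) a × DistTo G v (λ w → f w ≡ i) b × a ≢ b

separated-sym : ∀ {n p} {G : Graph n} {f : Fin n → Fin p} {u v} →
                Separated G f u v → Separated G f v u
separated-sym (i , a , b , da , db , a≢b) = i , b , a , db , da , λ e → a≢b (sym e)

module Distances {n : ℕ} (G : Graph n) (conn : Connected G) where

  walk? : ∀ u v m → Dec (Walk G u v m)
  walk? u v zero with u ≟ v
  ... | yes refl = yes here
  ... | no u≢v   = no λ { here → u≢v refl }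
  walk? u v (suc m) with any? (λ w → (adj G u w Bool.≟ true) ×-dec walk? w v m)
  ... | yes (w , e , p) = yes (step e p)
  ... | no none         = no λ { (step {w = w} e p) → none (w , e , p) }

  distance : ∀ u (S : Fin n → Set) → (∀ w → Dec (S w)) → ∀ z → S z →
             ∃ λ m → DistTo G u S m
  distance u S S? z sz with conn u z
  ... | m₀ , walk with least (λ m → ∃ λ w → S w × Walk G u w m)
                             (λ m → any? λ w → S? w ×-dec walk? u w m)
                             m₀ (z , sz , walk)
  ... | m , reach , minimal = m , reach , λ w l sw wl → minimal l (w , sw , wl)

  distance-member : ∀ {u S} → S u → DistTo G u S 0
  distance-member {u} su = (u , su , here) , λ _ _ _ _ → z≤n

  distance-nonmember : ∀ {u S a} → ¬ S u → DistTo G u S a → a ≢ 0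
  distance-nonmember ¬su ((w , sw , here) , _) refl = ¬su sw

  distance-neighbour : ∀ {u S a z} → S z → adj G u z ≡ true → DistTo G u S a → a ≤ 1
  distance-neighbour {z = z} sz e (_ , minimal) = minimal z 1 sz (step e here)

  distance-one : ∀ {u S} → DistTo G u S 1 → ∃ λ z → S z × adj G u z ≡ true
  distance-one ((z , sz , step e here) , _) = z , sz , e

  one-of : ∀ {a} → a ≤ 1 → a ≢ 0 → a ≡ 1
  one-of {zero}  _           a≢0 = ⊥-elim (a≢0 refl)
  one-of {suc zero} _        _   = refl
  one-of {suc (suc _)} (s≤s ()) _

  -- A vertex is separated from everything outside its own part: the part
  -- is at distance 0 from it and at positive distance from the others.
  own-part-separates : ∀ {p} (f : Fin n → Fin p) u v → f u ≢ f v → Separated G f u v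
  own-part-separates f u v fu≢fv with distance v (λ w → f w ≡ f u) (λ w → f w ≟ f u) u refl
  ... | b , db = f u , 0 , b , distance-member refl , db ,
                 λ 0≡b → distance-nonmember (λ e → fu≢fv (sym e)) db (sym 0≡b)

  -- If z is alone in its part, a neighbour u of z is at distance 1 from
  -- that part, while a non-neighbour v of z is not.
  isolated-separates : ∀ {p} (f : Fin n → Fin p) z → (∀ y → f y ≡ f z → y ≡ z) →
                       ∀ u v → adj G u z ≡ true → adj G v z ≡ false → Separated G f u v
  isolated-separates f z alone u v uz vz
    with distance u (λ w → f w ≡ f z) (λ w → f w ≟ f z) z refl
       | distance v (λ w → f w ≡ f z) (λ w → f w ≟ f z) z refl
  ... | a , da | b , db = f z , a , b , da , db , λ a≡b → b≢1 (trans (sym a≡b) a≡1)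
    where
    u∉part : ¬ (f u ≡ f z)
    u∉part e with alone u e
    ... | refl with trans (sym uz) (irrefl G u)
    ...   | ()
    a≡1 : a ≡ 1
    a≡1 = one-of (distance-neighbour refl uz da) (distance-nonmember u∉part da)
    b≢1 : b ≢ 1
    b≢1 refl with distance-one db
    ... | y , fy≡fz , vy with alone y fy≡fz
    ...   | refl with trans (sym vy) vz
    ...     | ()

  isolated-distinguishes : ∀ {p} (f : Fin n → Fin p) z → (∀ y → f y ≡ f z → y ≡ z) →
                           ∀ u v → adj G u z ≢ adj G v z → Separated G f u v
  isolated-distinguishes f z alone u v differ with adj G u z in uz | adj G v z in vz
  ... | true  | false = isolated-separates f z alone u v uz vz
  ... | false | true  = separated-sym (isolated-separates f z alone v u vz uz)
  ... | true  | true  = ⊥-elim (differ refl)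
  ... | false | false = ⊥-elim (differ refl)

  -- A surjective labelling is a locating partition as soon as vertices
  -- sharing a part are separated; the rest are separated by their own part.
  locating-criterion : ∀ {p} (f : Fin n → Fin p) → (∀ i → ∃ λ w → f w ≡ i) →
                       (∀ u v → u ≢ v → f u ≡ f v → Separated G f u v) →
                       IsLocatingPartition G p f
  locating-criterion f onto same-part = onto , separate
    where
    separate : ∀ u v → u ≢ v → Separated G f u v
    separate u v u≢v with f u ≟ f v
    ... | yes fu≡fv = same-part u v u≢v fu≡fv
    ... | no fu≢fv  = own-part-separates f u v fu≢fv

smaller-half : ∀ d c m → d + c ≡ m → 2 * d ≤ m ⊎ 2 * c ≤ m
smaller-half d c m d+c≡m with 2 * d ≤? m | 2 * c ≤? m
... | yes small | _         = inj₁ small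
... | no _      | yes small = inj₂ small
... | no big-d  | no big-c  = ⊥-elim (<-irrefl too-big (+-mono-< (≰⇒> big-d) (≰⇒> big-c)))
  where
  too-big : m + m ≡ 2 * d + 2 * c
  too-big = begin
    m + m           ≡⟨ cong (m +_) (sym (+-identityʳ m)) ⟩
    2 * m           ≡⟨ cong (2 *_) (sym d+c≡m) ⟩
    2 * (d + c)     ≡⟨ *-distribˡ-+ 2 d c ⟩
    2 * d + 2 * c   ∎
    where open ≡-Reasoning

-- Take a minimal dominating set D; by
-- minimality its complement dominates as well, and one of the two is small.
module HalfDomination {m : ℕ} (A : Fin m → Set) (A? : ∀ j → Dec (A j))
  (R : Fin m → Fin m → Set) (R? : ∀ j s → Dec (R j s))
  (partner : ∀ a → A a → ∃ λ s → s ≢ a × R a s)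
  (R-sym : ∀ a s → A a → A s → R a s → R s a) where

  DominatedBy : Subset m → Fin m → Set
  DominatedBy D j = A j → j ∉ D → ∃ λ s → s ∈ D × R j s

  Dominating : Subset m → Set
  Dominating D = ∀ j → DominatedBy D j

  dominatedBy? : ∀ D j → Dec (DominatedBy D j)
  dominatedBy? D j = A? j →-dec (¬? (j ∈? D) →-dec any? λ s → (s ∈? D) ×-dec R? j s)

  Minimal : Subset m → Set
  Minimal D = ∀ a → a ∈ D → ¬ Dominating (D - a)

  minimal-dominating : ∀ N D → ∣ D ∣ ≤ N → Dominating D →
                       ∃ λ D′ → Dominating D′ × Minimal D′
  minimal-dominating N D size dom
    with any? (λ a → (a ∈? D) ×-dec all? (dominatedBy? (D - a)))
  ... | no irreducible = D , dom , λ a a∈D dom′ → irreducible (a , a∈D , dom′)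
  minimal-dominating zero D size dom | yes (a , a∈D , _) =
    ⊥-elim (<-irrefl refl (<-≤-trans (x∈p⇒∣p-x∣<∣p∣ a∈D) (≤-trans size z≤n)))
  minimal-dominating (suc N) D size dom | yes (a , a∈D , dom′) =
    minimal-dominating N (D - a) (≤-pred (<-≤-trans (x∈p⇒∣p-x∣<∣p∣ a∈D) size)) dom′

  undominated : ∀ D j → ¬ DominatedBy D j → A j × j ∉ D × ¬ (∃ λ s → s ∈ D × R j s)
  undominated D j fails with A? j
  ... | yes aj = aj , (λ j∈D → fails λ _ j∉D → ⊥-elim (j∉D j∈D)) , λ found → fails λ _ _ → found
  ... | no ¬aj = ⊥-elim (fails λ aj → ⊥-elim (¬aj aj))

  -- In a minimal dominating set D, each a ∈ D ∩ A has a partner outside D: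
  -- the element left undominated by D - a is either a itself, whose partner
  -- then lies outside D, or an element outside D whose only partner in D is a.
  partner-outside : ∀ D → Dominating D → Minimal D → ∀ a → A a → a ∈ D →
                    ∃ λ s → s ∉ D × R a s
  partner-outside D dom minimal a aa a∈D
    with ¬∀⟶∃¬ m (DominatedBy (D - a)) (dominatedBy? (D - a)) (minimal a a∈D)
  ... | j , fails with undominated (D - a) j fails
  ... | aj , j∉D-a , partnerless with j ≟ a
  ...   | yes refl with partner a aa
  ...     | s , s≢a , ras with s ∈? D
  ...       | yes s∈D = ⊥-elim (partnerless (s , x∈p∧x≢y⇒x∈p-y s∈D s≢a , ras))
  ...       | no s∉D  = s , s∉D , ras
  partner-outside D dom minimal a aa a∈D | j , fails | aj , j∉D-a , partnerless | no j≢a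
    with dom j aj (λ j∈D → j∉D-a (x∈p∧x≢y⇒x∈p-y j∈D j≢a))
  ... | s , s∈D , rjs with s ≟ a
  ...   | yes refl = j , (λ j∈D → j∉D-a (x∈p∧x≢y⇒x∈p-y j∈D j≢a)) , R-sym j s aj aa rjs
  ...   | no s≢a   = ⊥-elim (partnerless (s , x∈p∧x≢y⇒x∈p-y s∈D s≢a , rjs))

  complement-dominating : ∀ D → Dominating D → Minimal D → Dominating (∁ D)
  complement-dominating D dom minimal j aj j∉∁D
    with partner-outside D dom minimal j aj (x∉∁p⇒x∈p j∉∁D)
  ... | s , s∉D , rjs = s , x∉p⇒x∈∁p s∉D , rjs

  complement-size : ∀ D → ∣ D ∣ + ∣ ∁ D ∣ ≡ m
  complement-size D = trans (cong (∣ D ∣ +_) (∣∁p∣≡n∸∣p∣ D)) (m+[n∸m]≡n (∣p∣≤n D))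

  half-dominating : ∃ λ S → Dominating S × 2 * ∣ S ∣ ≤ m
  half-dominating with minimal-dominating m ⊤ (∣p∣≤n ⊤) (λ j _ j∉⊤ → ⊥-elim (j∉⊤ ∈⊤))
  ... | D , dom , minimal with smaller-half ∣ D ∣ ∣ ∁ D ∣ m (complement-size D)
  ... | inj₁ small = D , dom , small
  ... | inj₂ small = ∁ D , complement-dominating D dom minimal , small

module TwinFacts {n : ℕ} (G : Graph n) where

  twins? : ∀ u v → Dec (Twins G u v)
  twins? u v = all? λ w → ¬? (w ≟ u) →-dec (¬? (w ≟ v) →-dec (adj G u w Bool.≟ adj G v w))

  non-twins-witness : ∀ u v → ¬ Twins G u v →
                      ∃ λ z → z ≢ u × z ≢ v × adj G u z ≢ adj G v z
  non-twins-witness u v ¬twins with ¬∀⟶∃¬ n _ (λ w → ¬? (w ≟ u) →-dec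
                                     (¬? (w ≟ v) →-dec (adj G u w Bool.≟ adj G v w))) ¬twins
  ... | z , fails = z , (λ z≡u → fails λ z≢u _ → ⊥-elim (z≢u z≡u))
                      , (λ z≡v → fails λ _ z≢v → ⊥-elim (z≢v z≡v))
                      , (λ same → fails λ _ _ → same)

  -- A τ-set contains every twin of its members: the twin class of w ∈ W
  -- contains W, so an extra twin would make a twin class larger than τ(G).
  τ-set-absorbs-twins : ∀ t → IsTau G t → ∀ W → TwinSet G W → ∣ W ∣ ≡ t →
                        ∀ w v → w ∈ W → Twins G w v → v ∈ W
  τ-set-absorbs-twins t tau W twinW ∣W∣≡t w v w∈W twin with v ∈? W
  ... | yes v∈W = v∈W
  ... | no v∉W  = ⊥-elim (<-irrefl refl (<-≤-trans (p⊂q⇒∣p∣<∣q∣ W⊂C)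
                     (subst (∣ C ∣ ≤_) (sym ∣W∣≡t) (proj₂ tau C class))))
    where
    C : Subset n
    C = tabulate λ y → does (twins? w y)
    into : ∀ y → Twins G w y → y ∈ C
    into y twin′ = lookup⇒[]= y C (trans (lookup∘tabulate _ y) (dec-true (twins? w y) twin′))
    out : ∀ y → y ∈ C → Twins G w y
    out y y∈C = accepted (twins? w y) (trans (sym (lookup∘tabulate _ y)) ([]=⇒lookup y∈C))
      where
      accepted : ∀ {P : Set} (d : Dec P) → does d ≡ true → P
      accepted (yes p) _ = p
      accepted (no _) ()
    class : TwinClass G C
    class = w , λ y → mk⇔ (out y) (into y)
    W⊂C : W ⊂ C
    W⊂C = (λ {y} y∈W → into y (twinW w y w∈W y∈W)) , v , into v twin , v∉W

module Construction {n : ℕ} (G : Graph n) (conn : Connected G) (t : ℕ) (tau : IsTau G t)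
  (W : Subset n) (twinW : TwinSet G W) (∣W∣≡t : ∣ W ∣ ≡ t) (cliqueW : InducesComplete G W)
  (X<W : ∣ ∁ W ∣ < ∣ W ∣) where

  open Distances G conn
  open TwinFacts G

  #W = ∣ W ∣
  #X = ∣ ∁ W ∣
  module EW = Enumeration (enumerate W)
  module EX = Enumeration (enumerate (∁ W))

  w : Fin #W → Fin n
  w = EW.element
  x : Fin #X → Fin n
  x = EX.element

  data Side : Fin n → Set where
    inW : ∀ i → Side (w i)
    inX : ∀ j → Side (x j)

  side : ∀ v → Side v
  side v with v ∈? W
  ... | yes v∈W = subst Side (EW.element-index v v∈W) (inW (EW.index v v∈W))
  ... | no v∉W  = subst Side (EX.element-index v (x∉p⇒x∈∁p v∉W)) (inX (EX.index v (x∉p⇒x∈∁p v∉W)))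

  -- The hub: a vertex of W whose index is at least #X.
  K : Fin #W
  K = fromℕ< X<W
  hub : Fin n
  hub = w K

  x∉W : ∀ j → x j ∉ W
  x∉W j = x∈∁p⇒x∉p (EX.element∈ j)

  x≢W : ∀ j v → v ∈ W → x j ≢ v
  x≢W j v v∈W refl = x∉W j v∈W

  adjacency-to-W : ∀ i j → adj G (w i) (x j) ≡ adj G hub (x j)
  adjacency-to-W i j = twinW (w i) hub (EW.element∈ i) (EW.element∈ K) (x j)
                         (x≢W j _ (EW.element∈ i)) (x≢W j _ (EW.element∈ K))

  w-adjacent : ∀ i i′ → i ≢ i′ → adj G (w i) (w i′) ≡ true
  w-adjacent i i′ i≢i′ = cliqueW _ _ (EW.element∈ i) (EW.element∈ i′)
                           (λ e → i≢i′ (EW.element-injective i i′ e))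

  SeesW : Fin #X → Set
  SeesW j = adj G (x j) hub ≡ true

  Distinguishes : Fin #X → Fin #X → Set
  Distinguishes j s = adj G (x j) (x s) ≢ adj G hub (x s)

  -- A vertex of X seeing W is no twin of the hub; the vertex telling them
  -- apart is not in W, as W is a clique of twins.
  distinguisher : ∀ j → SeesW j → ∃ λ s → s ≢ j × Distinguishes j s
  distinguisher j sees
    with non-twins-witness hub (x j)
           (λ twin → x∉W j (τ-set-absorbs-twins t tau W twinW ∣W∣≡t hub (x j) (EW.element∈ K) twin))
  ... | z , z≢hub , z≢xj , differ with z ∈? W
  ... | yes z∈W = ⊥-elim (differ (trans hub-z (sym xj-z)))
    where
    hub-z : adj G hub z ≡ true
    hub-z = cliqueW hub z (EW.element∈ K) z∈W (λ e → z≢hub (sym e))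
    xj-z : adj G (x j) z ≡ true
    xj-z = begin
      adj G (x j) z  ≡⟨ Graph.sym G (x j) z ⟩
      adj G z (x j)  ≡⟨ twinW z hub z∈W (EW.element∈ K) (x j) (λ e → z≢xj (sym e))
                          (x≢W j hub (EW.element∈ K)) ⟩
      adj G hub (x j) ≡⟨ Graph.sym G hub (x j) ⟩
      adj G (x j) hub ≡⟨ sees ⟩
      true            ∎
      where open ≡-Reasoning
  ... | no z∉W = s , (λ s≡j → z≢xj (trans (sym xs≡z) (cong x s≡j)))
                   , (λ same → differ (sym (subst (λ y → adj G (x j) y ≡ adj G hub y) xs≡z same)))
    where
    s = EX.index z (x∉p⇒x∈∁p z∉W)
    xs≡z : x s ≡ z
    xs≡z = EX.element-index z (x∉p⇒x∈∁p z∉W)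

  -- Between vertices seeing W, distinguishing is symmetric: it means non-adjacency.
  distinguishes-sym : ∀ j s → SeesW j → SeesW s → Distinguishes j s → Distinguishes s j
  distinguishes-sym j s sj ss differ same = differ (trans xj-xs (sym hub-xs))
    where
    hub-xs : adj G hub (x s) ≡ true
    hub-xs = trans (Graph.sym G hub (x s)) ss
    xj-xs : adj G (x j) (x s) ≡ true
    xj-xs = trans (Graph.sym G (x j) (x s))
              (trans same (trans (Graph.sym G hub (x j)) sj))

  open HalfDomination SeesW (λ j → adj G (x j) hub Bool.≟ true)
                      Distinguishes (λ j s → ¬? (adj G (x j) (x s) Bool.≟ adj G hub (x s)))
                      distinguisher distinguishes-sym public

  module Partition (S : Subset #X) (S-dominating : Dominating S) where

    #S = ∣ S ∣
    module ES = Enumeration (enumerate S)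

    -- Vertices x j outside S share the part of w (mate j); the hub is no mate.
    mate : Fin #X → Fin #W
    mate j = inject≤ j (<⇒≤ X<W)

    mate≢K : ∀ j → mate j ≢ K
    mate≢K j e = <⇒≢ (toℕ<n j)
      (trans (sym (toℕ-inject≤ j (<⇒≤ X<W))) (trans (cong toℕ e) (toℕ-fromℕ< X<W)))

    -- Parts are coded by Fin #W (parts of W) or Fin #S (singletons {x s}, s ∈ S).
    Code = Fin #W ⊎ Fin #S

    codeX : Fin #X → Code
    codeX j with j ∈? S
    ... | yes j∈S = inj₂ (ES.index j j∈S)
    ... | no _    = inj₁ (mate j)

    code : Fin n → Code
    code v with v ∈? W
    ... | yes v∈W = inj₁ (EW.index v v∈W)
    ... | no v∉W  = codeX (EX.index v (x∉p⇒x∈∁p v∉W))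

    code-w : ∀ i → code (w i) ≡ inj₁ i
    code-w i with w i ∈? W
    ... | yes wi∈W = cong inj₁ (EW.index-element i wi∈W)
    ... | no wi∉W  = ⊥-elim (wi∉W (EW.element∈ i))

    code-x : ∀ j → code (x j) ≡ codeX j
    code-x j with x j ∈? W
    ... | yes xj∈W = ⊥-elim (x∉W j xj∈W)
    ... | no _     = cong codeX (EX.index-element j _)

    codeX-element : ∀ r → codeX (ES.element r) ≡ inj₂ r
    codeX-element r with ES.element r ∈? S
    ... | yes r∈S = cong inj₂ (ES.index-element r r∈S)
    ... | no r∉S  = ⊥-elim (r∉S (ES.element∈ r))

    codeX-mate : ∀ j i → codeX j ≡ inj₁ i → j ∉ S × mate j ≡ i
    codeX-mate j i eq with j ∈? S
    codeX-mate j i () | yes _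
    codeX-mate j i refl | no j∉S = j∉S , refl

    codeX-injective : ∀ j j′ → codeX j ≡ codeX j′ → j ≡ j′
    codeX-injective j j′ eq with j ∈? S | j′ ∈? S
    codeX-injective j j′ eq   | yes j∈S | yes j′∈S =
      ES.index-injective j j′ j∈S j′∈S (inj₂-injective eq)
    codeX-injective j j′ ()   | yes _ | no _
    codeX-injective j j′ ()   | no _  | yes _
    codeX-injective j j′ eq   | no _  | no _  = toℕ-injective (begin
      toℕ j        ≡⟨ sym (toℕ-inject≤ j (<⇒≤ X<W)) ⟩
      toℕ (mate j)  ≡⟨ cong toℕ (inj₁-injective eq) ⟩
      toℕ (mate j′) ≡⟨ toℕ-inject≤ j′ (<⇒≤ X<W) ⟩
      toℕ j′       ∎)
      where open ≡-Reasoning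

    label : Fin n → Fin (#W + #S)
    label v = join #W #S (code v)

    same-code : ∀ y z → label y ≡ label z → code y ≡ code z
    same-code y z eq = trans (sym (splitAt-join #W #S (code y)))
                         (trans (cong (splitAt #W) eq) (splitAt-join #W #S (code z)))

    label-onto : ∀ ℓ → ∃ λ v → label v ≡ ℓ
    label-onto ℓ with splitAt #W ℓ in eq
    ... | inj₁ i = w i , trans (cong (join #W #S) (code-w i))
                                (trans (cong (join #W #S) (sym eq)) (join-splitAt #W #S ℓ))
    ... | inj₂ r = x (ES.element r) ,
                   trans (cong (join #W #S) (trans (code-x _) (codeX-element r)))
                         (trans (cong (join #W #S) (sym eq)) (join-splitAt #W #S ℓ))

    hub-alone : ∀ y → label y ≡ label hub → y ≡ hub
    hub-alone y eq with side y | same-code y hub eq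
    ... | inW i | eq′ = cong w (inj₁-injective (trans (sym (code-w i)) (trans eq′ (code-w K))))
    ... | inX j | eq′ = ⊥-elim (mate≢K j (proj₂ (codeX-mate j K
                          (trans (sym (code-x j)) (trans eq′ (code-w K))))))

    S-alone : ∀ s → s ∈ S → ∀ y → label y ≡ label (x s) → y ≡ x s
    S-alone s s∈S y eq with side y | same-code y (x s) eq
    ... | inW i | eq′ = ⊥-elim (proj₁ (codeX-mate s i
                          (trans (sym (code-x s)) (trans (sym eq′) (code-w i)))) s∈S)
    ... | inX j | eq′ = cong x (codeX-injective j s
                          (trans (sym (code-x j)) (trans eq′ (code-x s))))

    -- A vertex x j outside S and its mate are separated: by a distinguisher
    -- {x s} with s ∈ S if x j sees W, and by {hub} otherwise.
    mates-separated : ∀ j → j ∉ S → Separated G label (w (mate j)) (x j)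
    mates-separated j j∉S with adj G (x j) hub Bool.≟ true
    ... | yes sees with S-dominating j sees j∉S
    ...   | s , s∈S , differ =
            isolated-distinguishes label (x s) (S-alone s s∈S) (w (mate j)) (x j)
              λ same → differ (sym (trans (sym (adjacency-to-W (mate j) s)) same))
    mates-separated j j∉S | no blind =
      isolated-distinguishes label hub hub-alone (w (mate j)) (x j)
        λ same → blind (trans (sym same) (w-adjacent (mate j) K (mate≢K j)))

    -- Distinct vertices with the same label are a vertex x j ∉ S and its mate.
    same-label-separated : ∀ u v → u ≢ v → label u ≡ label v → Separated G label u v
    same-label-separated u v u≢v eq with side u | side v | same-code u v eq
    ... | inW i | inW i′ | eq′ =
      ⊥-elim (u≢v (cong w (inj₁-injective (trans (sym (code-w i)) (trans eq′ (code-w i′))))))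
    ... | inX j | inX j′ | eq′ =
      ⊥-elim (u≢v (cong x (codeX-injective j j′ (trans (sym (code-x j)) (trans eq′ (code-x j′))))))
    ... | inW i | inX j  | eq′ with codeX-mate j i (trans (sym (code-x j)) (trans (sym eq′) (code-w i)))
    ...   | j∉S , refl = mates-separated j j∉S
    same-label-separated u v u≢v eq | inX j | inW i | eq′
      with codeX-mate j i (trans (sym (code-x j)) (trans eq′ (code-w i)))
    ...   | j∉S , refl = separated-sym (mates-separated j j∉S)

    locating : IsLocatingPartition G (#W + #S) label
    locating = locating-criterion label label-onto same-label-separated

k<t : ∀ t k n → t + k ≡ n → n < 2 * t → k < t
k<t t k n t+k≡n n<2t = +-cancelˡ-< t k t
  (subst₂ _<_ (sym t+k≡n) (cong (t +_) (+-identityʳ t)) n<2t)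

parts-bound : ∀ t k n s → t + k ≡ n → 2 * s ≤ k → 2 * (t + s) ≤ 2 * n ∸ k
parts-bound t k n s refl 2s≤k = begin
  2 * (t + s)           ≡⟨ *-distribˡ-+ 2 t s ⟩
  2 * t + 2 * s         ≤⟨ +-monoʳ-≤ (2 * t) 2s≤k ⟩
  2 * t + k             ≡⟨ sym (m+n∸n≡m (2 * t + k) k) ⟩
  2 * t + k + k ∸ k     ≡⟨ cong (_∸ k) (+-assoc (2 * t) k k) ⟩
  2 * t + (k + k) ∸ k   ≡⟨ cong (λ m → 2 * t + m ∸ k) (cong (k +_) (sym (+-identityʳ k))) ⟩
  2 * t + 2 * k ∸ k     ≡⟨ cong (_∸ k) (sym (*-distribˡ-+ 2 t k)) ⟩
  2 * (t + k) ∸ k       ∎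
  where open ≤-Reasoning

mainTheorem10 : (n k : ℕ) (G : Graph n) → Connected G →
    (t : ℕ) → IsTau G t → n < 2 * t → t + k ≡ n →
    (W : Subset n) → TwinSet G W → ∣ W ∣ ≡ t →
    InducesComplete G W →
    ∃ λ p → ∃ λ (f : Fin n → Fin p) →
      IsLocatingPartition G p f × 2 * p ≤ 2 * n ∸ k
mainTheorem10 n k G conn t tau n<2t t+k≡n W twinW ∣W∣≡t cliqueW =
  partition half-dominating
  where
  ∣X∣≡k : ∣ ∁ W ∣ ≡ k
  ∣X∣≡k = trans (∣∁p∣≡n∸∣p∣ W)
            (trans (cong (n ∸_) ∣W∣≡t) (trans (cong (_∸ t) (sym t+k≡n)) (m+n∸m≡n t k)))
  X<W : ∣ ∁ W ∣ < ∣ W ∣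
  X<W = subst₂ _<_ (sym ∣X∣≡k) (sym ∣W∣≡t) (k<t t k n t+k≡n n<2t)
  open Construction G conn t tau W twinW ∣W∣≡t cliqueW X<W
  partition : (∃ λ S → Dominating S × 2 * ∣ S ∣ ≤ ∣ ∁ W ∣) →
              ∃ λ p → ∃ λ (f : Fin n → Fin p) → IsLocatingPartition G p f × 2 * p ≤ 2 * n ∸ k
  partition (S , S-dominating , S-small) =
    ∣ W ∣ + ∣ S ∣ , label , locating ,
    subst (λ a → 2 * (a + ∣ S ∣) ≤ 2 * n ∸ k) (sym ∣W∣≡t)
      (parts-bound t k n ∣ S ∣ t+k≡n (subst (2 * ∣ S ∣ ≤_) ∣X∣≡k S-small))
    where open Partition S S-dominating
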